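{- Let $n,k \geq 1$, let $\rho \in \mathcal{P}_k$, let $\sigma \in \mathcal{I}_n$, let $\ell \in [0,k-1]$ be such that $k-\ell \in \mathbf{Sat}(\rho)$, let $r_1 < \dots < r_k$ be elements of $[1,n]$ such that $(\sigma_{r_i})_{i \in [1,k]}$ is an occurrence of $\rho$, and let $R := \{r_i\}_{i \in [1,k]}$. If $\sigma$ is a $\rho$-minimal inversion sequence, then: 1. for all $i \in [1,n]$, if $\sigma_i \geq \sigma_{r_{k-\ell}}$, then $i \in R$; 2. for all $i \in [0,\ell]$, $r_{k-i} = n-i$; 3. $n-\ell \in \mathbf{Sat}(\sigma)$.
   Context: For integers $a \le b$, $[a,b]=\{k\in\mathbb Z : a\le k\le b\}$. An inversion sequence of length $n$ is an integer sequence $\sigma=(\sigma_1,\dots,\sigma_n)$ with $\sigma_i\in\{0,\dots,i-1\}$ for all $i$; $\mathcal{I}_n$ is the set of these and $\mathcal I=\bigcup_n \mathcal I_n$. A Cayley permutation of length $n$ is an integer sequence of length $n$ whose set of values is exactly $\{0,\dots,m\}$ for its maximum $m$; $\mathcal{P}_n$ is the set of these and $\mathcal P=\bigcup_n\mathcal P_n$. For integer sequences $\sigma$ (length $n$) and $\rho$ (length $k$, $1\le k\le n$), $\sigma$ contains $\rho$ (written $\rho\preceq\sigma$) if some subsequence of $k$ entries of $\sigma$ has its values in the same relative order as $\rho$; such a subsequence is an occurrence of $\rho$. For a nonnegative integer sequence $\sigma$ of length $n\ge1$: $\mathbf{mdd}(\sigma)=\max_{i\in[1,n]}(\sigma_i-i+1)$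 and $\mathbf{Sat}(\sigma)=\{i\in[1,n]:\sigma_i-i+1=\mathbf{mdd}(\sigma)\}$. For a nonempty Cayley permutation $\rho$, let $\mathcal{IP}[\rho]=\{\sigma\in\mathcal I\cap\mathcal P : \rho\preceq\sigma\}$; $\sigma$ is a $\rho$-minimal inversion sequence if it is a minimal element of the poset $(\mathcal{IP}[\rho],\preceq)$. -}

module Defs where

open import Data.Nat using (ℕ; zero; suc; _≤_; _<_; _⊔_)
open import Data.Integer as ℤ using (ℤ; +_; _-_)
open import Data.Fin as Fin using (Fin; toℕ)
open import Data.List using (List; []; _∷_; length; lookup; tabulate; foldr)
open import Data.Product using (Σ; ∃; _×_; _,_)
open import Function.Bundles using (_⇔_)
open import Relation.Binary.PropositionalEquality using (_≡_)

-- Sequences are lists of naturals; positions are 0-based: position p : Fin (length σ)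
-- corresponds to the paper's index i = toℕ p + 1.

IsInversion : List ℕ → Set
IsInversion σ = (p : Fin (length σ)) → lookup σ p ≤ toℕ p

maxL : List ℕ → ℕ
maxL = foldr _⊔_ 0

IsCayley : List ℕ → Set
IsCayley σ = (v : ℕ) → (∃ λ (p : Fin (length σ)) → lookup σ p ≡ v) ⇔ (v ≤ maxL σ)

IsOccurrence : (ρ σ : List ℕ) → (Fin (length ρ) → Fin (length σ)) → Set
IsOccurrence ρ σ r =
  ((i j : Fin (length ρ)) → i Fin.< j → r i Fin.< r j) ×
  ((i j : Fin (length ρ)) →
     ((lookup ρ i < lookup ρ j) ⇔ (lookup σ (r i) < lookup σ (r j))) ×
     ((lookup ρ i ≡ lookup ρ j) ⇔ (lookup σ (r i) ≡ lookup σ (r j))))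

Contains : List ℕ → List ℕ → Set
Contains ρ σ = (1 ≤ length ρ) × (Σ (Fin (length ρ) → Fin (length σ)) λ r → IsOccurrence ρ σ r)

InIP : List ℕ → List ℕ → Set
InIP ρ σ = IsInversion σ × IsCayley σ × Contains ρ σ

IsMinimal : List ℕ → List ℕ → Set
IsMinimal ρ σ = InIP ρ σ × ((τ : List ℕ) → InIP ρ τ → Contains τ σ → τ ≡ σ)

-- σ_i - i + 1 at 0-based position p, i.e. σ[p] - p
dd : (σ : List ℕ) → Fin (length σ) → ℤ
dd σ p = + lookup σ p - + toℕ p

maxZ : List ℤ → ℤ
maxZ [] = + 0
maxZ (x ∷ xs) = foldr ℤ._⊔_ x xs

mdd : List ℕ → ℤ
mdd σ = maxZ (tabulate (dd σ))

InSat : (σ : List ℕ) → Fin (length σ) → Set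
InSat σ p = dd σ p ≡ mdd σ

-- Write S and P for σ and ρ, R for the positions of the occurrence, s = k − ℓ for the
-- saturated position of ρ and v = S (R s). Minimality is used through one principle: if
-- some positions of σ, including all of R, are kept and their entries relabelled
-- order-preservingly so that the result is again an inversion sequence and a Cayley
-- permutation, then all positions were kept, for the result lies in IP[ρ] below σ.
--
-- (1) Keep R and the entries below v, and relabel the entries of R that are ≥ v as
-- v + (P b − P s): saturation of s makes this an inversion sequence, so every entry ≥ v
-- lies in R.
-- (2, 3) Let i be the last position outside R and suppose R s < i or v < R s. Comparing
-- the growth of R, P and S ∘ R around s (by (1) and saturation) shows that no entry after
-- i is tight, i.e. S p < p for p > i; so deleting entry i, and closing up the values if
-- S i is unique, leaves an inversion sequence, against the principle. Hence all positions
-- from R s on lie in R, R is consecutive from s up to n − 1, and v = R s: the entry at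
-- R s is tight, which for an inversion sequence means saturated.

module Submission where

open import Data.Nat using (ℕ; _≤_; _∸_)
open import Data.Fin using (Fin; toℕ; opposite)
open import Data.List using (List; length; lookup)
open import Data.Product using (Σ; ∃; _×_)
open import Relation.Binary.PropositionalEquality using (_≡_)
open import Defs
open import Level using (0ℓ)
open import Data.Nat using (zero; suc; _+_; _<_; z≤n; s≤s; s≤s⁻¹; _<?_; _≤?_; _≟_)
open import Data.Nat.Properties
import Data.Integer as ℤ
import Data.Integer.Properties as ℤ
open import Data.Fin as Fin using (fromℕ<)
import Data.Fin.Properties as Fin
open import Data.List using ([]; _∷_; tabulate; foldr)
open import Data.Product using (_,_; proj₁; proj₂)
open import Data.Sum using (_⊎_; inj₁; inj₂; [_,_]′)
open import Data.Empty using (⊥)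
open import Function using (_∘_)
open import Function.Bundles using (_⇔_; mk⇔; Equivalence)
open import Function.Construct.Composition using (_⇔-∘_)
open import Function.Construct.Symmetry using (⇔-sym)
open import Relation.Nullary using (¬_; yes; no; contradiction)
open import Relation.Nullary.Decidable using (_⊎-dec_; _×-dec_; ¬?)
open import Relation.Unary using (Pred; Decidable)
open import Relation.Binary.Definitions using (tri<; tri≈; tri>)
open import Relation.Binary.PropositionalEquality
  using (refl; sym; trans; cong; cong₂; subst; subst₂; _≢_; module ≡-Reasoning)

private variable
  K : Pred ℕ 0ℓ
  m : ℕ

-- Counting and selecting positions

count : Decidable K → ℕ → ℕ
count K? zero = 0
count K? (suc m) with K? 0
... | yes _ = suc (count (K? ∘ suc) m)
... | no _ = count (K? ∘ suc) m

count-suc-yes : (K? : Decidable K) → K 0 → count K? (suc m) ≡ suc (count (K? ∘ suc) m)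
count-suc-yes K? p0 with K? 0
... | yes _ = refl
... | no ¬p0 = contradiction p0 ¬p0

count-suc-no : (K? : Decidable K) → ¬ K 0 → count K? (suc m) ≡ count (K? ∘ suc) m
count-suc-no K? ¬p0 with K? 0
... | yes p0 = contradiction p0 ¬p0
... | no _ = refl

count-snoc-yes : (K? : Decidable K) → K m → count K? (suc m) ≡ suc (count K? m)
count-snoc-yes {m = zero} K? pm = count-suc-yes K? pm
count-snoc-yes {m = suc m} K? pm with K? 0
... | yes _ = cong suc (count-snoc-yes (K? ∘ suc) pm)
... | no _ = count-snoc-yes (K? ∘ suc) pm

count-snoc-no : (K? : Decidable K) → ¬ K m → count K? (suc m) ≡ count K? m
count-snoc-no {m = zero} K? ¬pm = count-suc-no K? ¬pm
count-snoc-no {m = suc m} K? ¬pm with K? 0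
... | yes _ = cong suc (count-snoc-no (K? ∘ suc) ¬pm)
... | no _ = count-snoc-no (K? ∘ suc) ¬pm

count≤ : (K? : Decidable K) → ∀ m → count K? m ≤ m
count≤ K? zero = z≤n
count≤ K? (suc m) with K? 0
... | yes _ = s≤s (count≤ (K? ∘ suc) m)
... | no _ = m≤n⇒m≤1+n (count≤ (K? ∘ suc) m)

count-≤-suc : (K? : Decidable K) → ∀ m → count K? m ≤ count K? (suc m)
count-≤-suc K? m with K? m
... | yes pm = subst (count K? m ≤_) (sym (count-snoc-yes K? pm)) (n≤1+n _)
... | no ¬pm = ≤-reflexive (sym (count-snoc-no K? ¬pm))

count-mono : (K? : Decidable K) → ∀ {m m′} → m ≤ m′ → count K? m ≤ count K? m′
count-mono K? {m′ = zero} z≤n = ≤-refl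
count-mono K? {m′ = suc m′} m≤m′ with m≤n⇒m<n∨m≡n m≤m′
... | inj₁ m<m′ = ≤-trans (count-mono K? (s≤s⁻¹ m<m′)) (count-≤-suc K? m′)
... | inj₂ refl = ≤-refl

count-< : (K? : Decidable K) → ∀ {m m′} → m < m′ → K m → count K? m < count K? m′
count-< K? m<m′ pm = subst (_≤ _) (count-snoc-yes K? pm) (count-mono K? m<m′)

count≡⇒all : (K? : Decidable K) → count K? m ≡ m → ∀ {q} → q < m → K q
count≡⇒all {m = suc m} K? full {q} q<m with K? 0
... | no _ = contradiction (subst (_≤ m) full (count≤ (K? ∘ suc) m)) (n≮n m)
count≡⇒all {m = suc m} K? full {zero} q<m | yes p0 = p0
count≡⇒all {m = suc m} K? full {suc q} q<m | yes _ = count≡⇒all (K? ∘ suc) (suc-injective full) (s≤s⁻¹ q<m)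

≤-count : (K? : Decidable K) → ∀ {c m} → c ≤ m → (∀ {q} → q < m → ¬ K q → c ≤ q) → c ≤ count K? m
≤-count K? {zero} _ _ = z≤n
≤-count K? {suc c} {suc m} c<m dropped≥ with K? m
... | yes pm = subst (suc c ≤_) (sym (count-snoc-yes K? pm))
                 (s≤s (≤-count K? (s≤s⁻¹ c<m) λ q<m ¬pq → ≤-trans (n≤1+n c) (dropped≥ (m≤n⇒m≤1+n q<m) ¬pq)))
... | no ¬pm = subst (suc c ≤_) (sym (count-snoc-no K? ¬pm))
                 (≤-count K? (dropped≥ ≤-refl ¬pm) λ q<m ¬pq → dropped≥ (m≤n⇒m≤1+n q<m) ¬pq)

select : Decidable K → (ℕ → ℕ) → ℕ → List ℕ
select K? f zero = []
select K? f (suc m) with K? 0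
... | yes _ = f 0 ∷ select (K? ∘ suc) (f ∘ suc) m
... | no _ = select (K? ∘ suc) (f ∘ suc) m

length-select : (K? : Decidable K) (f : ℕ → ℕ) → ∀ m → length (select K? f m) ≡ count K? m
length-select K? f zero = refl
length-select K? f (suc m) with K? 0
... | yes _ = cong suc (length-select (K? ∘ suc) (f ∘ suc) m)
... | no _ = length-select (K? ∘ suc) (f ∘ suc) m

record SelectedAt {K : Pred ℕ 0ℓ} (K? : Decidable K) (f : ℕ → ℕ) (m j x : ℕ) : Set where
  field
    position : ℕ
    position<m : position < m
    kept : K position
    rank : j ≡ count K? position
    value : x ≡ f position

lookup-select : (K? : Decidable K) (f : ℕ → ℕ) → ∀ m (j : Fin (length (select K? f m))) →
  SelectedAt K? f m (toℕ j) (lookup (select K? f m) j)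
lookup-select K? f (suc m) j with K? 0
lookup-select K? f (suc m) Fin.zero | yes p0 = record
  { position = 0 ; position<m = s≤s z≤n ; kept = p0 ; rank = refl ; value = refl }
lookup-select K? f (suc m) (Fin.suc j) | yes p0 = record
  { position = suc position ; position<m = s≤s position<m ; kept = kept
  ; rank = trans (cong suc rank) (sym (count-suc-yes K? p0)) ; value = value }
  where open SelectedAt (lookup-select (K? ∘ suc) (f ∘ suc) m j)
... | no ¬p0 = record
  { position = suc position ; position<m = s≤s position<m ; kept = kept
  ; rank = trans rank (sym (count-suc-no K? ¬p0)) ; value = value }
  where open SelectedAt (lookup-select (K? ∘ suc) (f ∘ suc) m j)

select-index : (K? : Decidable K) (f : ℕ → ℕ) → ∀ {m p} → p < m → K p →
  Σ (Fin (length (select K? f m))) λ j → (toℕ j ≡ count K? p) × (lookup (select K? f m) j ≡ f p)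
select-index K? f {suc m} {zero} _ p0 with K? 0
... | yes _ = Fin.zero , refl , refl
... | no ¬p0 = contradiction p0 ¬p0
select-index K? f {suc m} {suc p} p<m pp with K? 0 | select-index (K? ∘ suc) (f ∘ suc) (s≤s⁻¹ p<m) pp
... | yes _ | j , rank , value = Fin.suc j , cong suc rank , value
... | no _ | j , rank , value = j , rank , value

-- Lists as functions on ℕ

at : List ℕ → ℕ → ℕ
at [] _ = 0
at (x ∷ xs) zero = x
at (x ∷ xs) (suc p) = at xs p

lookup≡at : ∀ (xs : List ℕ) (j : Fin (length xs)) → lookup xs j ≡ at xs (toℕ j)
lookup≡at (x ∷ xs) Fin.zero = refl
lookup≡at (x ∷ xs) (Fin.suc j) = lookup≡at xs j

lookup≤maxL : ∀ (xs : List ℕ) (j : Fin (length xs)) → lookup xs j ≤ maxL xs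
lookup≤maxL (x ∷ xs) Fin.zero = m≤m⊔n x (maxL xs)
lookup≤maxL (x ∷ xs) (Fin.suc j) = ≤-trans (lookup≤maxL xs j) (m≤n⊔m x (maxL xs))

maxL-attained : ∀ (xs : List ℕ) → 1 ≤ length xs → ∃ λ j → lookup xs j ≡ maxL xs
maxL-attained (x ∷ []) _ = Fin.zero , sym (⊔-identityʳ x)
maxL-attained (x ∷ y ∷ ys) _ with ⊔-sel x (maxL (y ∷ ys)) | maxL-attained (y ∷ ys) (s≤s z≤n)
... | inj₁ x⊔m≡x | _ = Fin.zero , sym x⊔m≡x
... | inj₂ x⊔m≡m | j , j≡m = Fin.suc j , trans j≡m (sym x⊔m≡m)

DownClosed : (ℕ → ℕ) → ℕ → Set
DownClosed S n = ∀ {q w} → q < n → w ≤ S q → ∃ λ p → p < n × S p ≡ w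

cayley⇒downClosed : ∀ (xs : List ℕ) → IsCayley xs → DownClosed (at xs) (length xs)
cayley⇒downClosed xs cayley {q} {w} q<n w≤ =
  toℕ i , Fin.toℕ<n i , trans (sym (lookup≡at xs i)) xs[i]≡w
  where
  j : Fin (length xs)
  j = fromℕ< q<n
  w≤max : w ≤ maxL xs
  w≤max = ≤-trans w≤ (subst (_≤ maxL xs) (trans (lookup≡at xs j) (cong (at xs) (Fin.toℕ-fromℕ< q<n)))
                                         (lookup≤maxL xs j))
  i : Fin (length xs)
  i = proj₁ (Equivalence.from (cayley w) w≤max)
  xs[i]≡w : lookup xs i ≡ w
  xs[i]≡w = proj₂ (Equivalence.from (cayley w) w≤max)

downClosed⇒cayley : ∀ (xs : List ℕ) → 1 ≤ length xs →
  (∀ j {w} → w ≤ lookup xs j → ∃ λ i → lookup xs i ≡ w) → IsCayley xs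
downClosed⇒cayley xs nonempty closed w =
  mk⇔ (λ (j , xs[j]≡w) → subst (_≤ maxL xs) xs[j]≡w (lookup≤maxL xs j))
      (λ w≤max → closed (proj₁ max) (subst (w ≤_) (sym (proj₂ max)) w≤max))
  where
  max : ∃ λ j → lookup xs j ≡ maxL xs
  max = maxL-attained xs nonempty

at-fromℕ< : ∀ (xs : List ℕ) {p} (p<n : p < length xs) → lookup xs (fromℕ< p<n) ≡ at xs p
at-fromℕ< xs p<n = trans (lookup≡at xs _) (cong (at xs) (Fin.toℕ-fromℕ< p<n))

inversion-at : ∀ (xs : List ℕ) → IsInversion xs → ∀ {p} → p < length xs → at xs p ≤ p
inversion-at xs inversion p<n = subst₂ _≤_ (at-fromℕ< xs p<n) (Fin.toℕ-fromℕ< p<n) (inversion (fromℕ< p<n))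

-- Relative order and occurrences

SameOrder : ℕ → ℕ → ℕ → ℕ → Set
SameOrder a b a′ b′ = ((a < b) ⇔ (a′ < b′)) × ((a ≡ b) ⇔ (a′ ≡ b′))

sameOrder-sym : ∀ {a b a′ b′} → SameOrder a b a′ b′ → SameOrder a′ b′ a b
sameOrder-sym (lt , eq) = ⇔-sym lt , ⇔-sym eq

sameOrder-trans : ∀ {a b a′ b′ a″ b″} → SameOrder a b a′ b′ → SameOrder a′ b′ a″ b″ → SameOrder a b a″ b″
sameOrder-trans (lt , eq) (lt′ , eq′) = lt′ ⇔-∘ lt , eq′ ⇔-∘ eq

sameOrder-fromMonotone : ∀ {a b a′ b′} → (a < b → a′ < b′) → (b < a → b′ < a′) → (a ≡ b → a′ ≡ b′) →
  SameOrder a b a′ b′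
sameOrder-fromMonotone {a} {b} lt gt eq = mk⇔ lt lt⁻¹ , mk⇔ eq eq⁻¹
  where
  lt⁻¹ : _ → a < b
  lt⁻¹ a′<b′ with <-cmp a b
  ... | tri< a<b _ _ = a<b
  ... | tri≈ _ a≡b _ = contradiction (eq a≡b) (<⇒≢ a′<b′)
  ... | tri> _ _ b<a = contradiction (gt b<a) (<-asym a′<b′)
  eq⁻¹ : _ → a ≡ b
  eq⁻¹ a′≡b′ with <-cmp a b
  ... | tri< a<b _ _ = contradiction a′≡b′ (<⇒≢ (lt a<b))
  ... | tri≈ _ a≡b _ = a≡b
  ... | tri> _ _ b<a = contradiction a′≡b′ (>⇒≢ (gt b<a))

sameOrder-cong : ∀ {a b a′ b′ c d c′ d′} → a ≡ c → b ≡ d → a′ ≡ c′ → b′ ≡ d′ →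
  SameOrder a b a′ b′ → SameOrder c d c′ d′
sameOrder-cong refl refl refl refl o = o

-- junk value 0 outside [0, k)
extend : ∀ {k m} → (Fin k → Fin m) → ℕ → ℕ
extend {k} r b with b <? k
... | yes b<k = toℕ (r (fromℕ< b<k))
... | no _ = 0

extend-toℕ : ∀ {k m} (r : Fin k → Fin m) (b : Fin k) → extend r (toℕ b) ≡ toℕ (r b)
extend-toℕ {k} r b with toℕ b <? k
... | yes b<k = cong (toℕ ∘ r) (Fin.fromℕ<-toℕ b b<k)
... | no b≮k = contradiction (Fin.toℕ<n b) b≮k

lookup∘r≡at∘extend : ∀ (σ : List ℕ) {k} (r : Fin k → Fin (length σ)) b → lookup σ (r b) ≡ at σ (extend r (toℕ b))
lookup∘r≡at∘extend σ r b = trans (lookup≡at σ (r b)) (cong (at σ) (sym (extend-toℕ r b)))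

extend-fromℕ< : ∀ {k m} (r : Fin k → Fin m) {b} (b<k : b < k) → extend r b ≡ toℕ (r (fromℕ< b<k))
extend-fromℕ< {k} r {b} b<k with b <? k
... | yes _ = refl
... | no b≮k = contradiction b<k b≮k

extend-< : ∀ {k m} (r : Fin k → Fin m) {b} → b < k → extend r b < m
extend-< r b<k = subst (_< _) (sym (extend-fromℕ< r b<k)) (Fin.toℕ<n _)

module OccurrenceOnℕ (ρ σ : List ℕ) (r : Fin (length ρ) → Fin (length σ)) (occ : IsOccurrence ρ σ r) where

  increasing : ∀ {b c} → b < c → c < length ρ → extend r b < extend r c
  increasing {b} b<c c<k = subst₂ _<_ (sym (extend-fromℕ< r b<k)) (sym (extend-fromℕ< r c<k))
    (proj₁ occ _ _ (subst₂ _<_ (sym (Fin.toℕ-fromℕ< b<k)) (sym (Fin.toℕ-fromℕ< c<k)) b<c))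
    where
    b<k : b < length ρ
    b<k = <-trans b<c c<k

  sameOrder : ∀ {b c} → b < length ρ → c < length ρ →
    SameOrder (at ρ b) (at ρ c) (at σ (extend r b)) (at σ (extend r c))
  sameOrder b<k c<k = sameOrder-cong (at-fromℕ< ρ b<k) (at-fromℕ< ρ c<k) (σ∘r b<k) (σ∘r c<k)
    (proj₂ occ (fromℕ< b<k) (fromℕ< c<k))
    where
    σ∘r : ∀ {b} (b<k : b < length ρ) → lookup σ (r (fromℕ< b<k)) ≡ at σ (extend r b)
    σ∘r b<k = trans (lookup≡at σ _) (cong (at σ) (sym (extend-fromℕ< r b<k)))

-- Minimality

-- The entries of σ at the positions in Keep, relabelled by f, form an inversion
-- sequence and a Cayley permutation which contains ρ and is contained in σ.
record Admissible (n k : ℕ) (S R : ℕ → ℕ) {Keep : Pred ℕ 0ℓ} (keep? : Decidable Keep) (f : ℕ → ℕ) : Set where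
  field
    keeps-R : ∀ {b} → b < k → Keep (R b)
    preserves-< : ∀ {p q} → p < n → q < n → Keep p → Keep q → S p < S q → f p < f q
    preserves-≡ : ∀ {p q} → p < n → q < n → Keep p → Keep q → S p ≡ S q → f p ≡ f q
    inversion : ∀ {p} → p < n → Keep p → f p ≤ count keep? p
    downClosed : ∀ {q w} → q < n → Keep q → w ≤ f q → ∃ λ p → p < n × Keep p × f p ≡ w

module Subsequence (ρ σ : List ℕ) (r : Fin (length ρ) → Fin (length σ)) (occ : IsOccurrence ρ σ r)
  {Keep : Pred ℕ 0ℓ} (keep? : Decidable Keep) (f : ℕ → ℕ)
  (adm : Admissible (length σ) (length ρ) (at σ) (extend r) keep? f) where

  open Admissible adm

  n : ℕ
  n = length σ
  τ : List ℕ
  τ = select keep? f n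

  sameOrder-kept : ∀ {p q} → p < n → q < n → Keep p → Keep q → SameOrder (at σ p) (at σ q) (f p) (f q)
  sameOrder-kept p<n q<n kp kq = sameOrder-fromMonotone
    (preserves-< p<n q<n kp kq) (preserves-< q<n p<n kq kp) (preserves-≡ p<n q<n kp kq)

  τ-inversion : IsInversion τ
  τ-inversion j = subst₂ _≤_ (sym value) (sym rank) (inversion position<m kept)
    where open SelectedAt (lookup-select keep? f n j)

  τ-downClosed : ∀ j {w} → w ≤ lookup τ j → ∃ λ i → lookup τ i ≡ w
  τ-downClosed j w≤ with lookup-select keep? f n j
  ... | record { position<m = p<n ; kept = kp ; value = τj≡fp }
      with downClosed p<n kp (subst (_ ≤_) τj≡fp w≤)
  ...   | q , q<n , kq , fq≡w with select-index keep? f q<n kq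
  ...     | i , _ , τi≡fq = i , trans τi≡fq fq≡w

  R-kept : ∀ (b : Fin (length ρ)) → Keep (extend r (toℕ b))
  R-kept b = keeps-R (Fin.toℕ<n b)

  R<n : ∀ (b : Fin (length ρ)) → extend r (toℕ b) < n
  R<n b = subst (_< n) (sym (extend-toℕ r b)) (Fin.toℕ<n (r b))

  rτ : Fin (length ρ) → Fin (length τ)
  rτ b = proj₁ (select-index keep? f (R<n b) (R-kept b))

  rτ-rank : ∀ b → toℕ (rτ b) ≡ count keep? (extend r (toℕ b))
  rτ-rank b = proj₁ (proj₂ (select-index keep? f (R<n b) (R-kept b)))

  rτ-value : ∀ b → lookup τ (rτ b) ≡ f (extend r (toℕ b))
  rτ-value b = proj₂ (proj₂ (select-index keep? f (R<n b) (R-kept b)))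

  τ-nonempty : 1 ≤ length ρ → 1 ≤ length τ
  τ-nonempty 1≤k = ≤-trans (s≤s z≤n) (Fin.toℕ<n (rτ (fromℕ< 1≤k)))

  ρ-in-τ : IsOccurrence ρ τ rτ
  ρ-in-τ = increasing , λ b c → sameOrder-trans
      (sameOrder-cong refl refl (lookup∘r≡at∘extend σ r b) (lookup∘r≡at∘extend σ r c) (proj₂ occ b c))
      (sameOrder-cong refl refl (sym (rτ-value b)) (sym (rτ-value c))
        (sameOrder-kept (R<n b) (R<n c) (R-kept b) (R-kept c)))
    where
    increasing : ∀ b c → b Fin.< c → rτ b Fin.< rτ c
    increasing b c b<c = subst₂ _<_ (sym (rτ-rank b)) (sym (rτ-rank c))
      (count-< keep? (subst₂ _<_ (sym (extend-toℕ r b)) (sym (extend-toℕ r c)) (proj₁ occ b c b<c)) (R-kept b))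

  position : Fin (length τ) → ℕ
  position j = SelectedAt.position (lookup-select keep? f n j)

  embed : Fin (length τ) → Fin n
  embed j = fromℕ< (SelectedAt.position<m (lookup-select keep? f n j))

  τ-in-σ : IsOccurrence τ σ embed
  τ-in-σ = increasing , order
    where
    toℕ-embed : ∀ j → toℕ (embed j) ≡ position j
    toℕ-embed j = Fin.toℕ-fromℕ< _
    increasing : ∀ i j → i Fin.< j → embed i Fin.< embed j
    increasing i j i<j = subst₂ _<_ (sym (toℕ-embed i)) (sym (toℕ-embed j)) (≰⇒> λ pj≤pi →
      <⇒≱ i<j (subst₂ _≤_ (sym (SelectedAt.rank sj)) (sym (SelectedAt.rank si)) (count-mono keep? pj≤pi)))
      where
      si : SelectedAt keep? f n (toℕ i) (lookup τ i)
      si = lookup-select keep? f n i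
      sj : SelectedAt keep? f n (toℕ j) (lookup τ j)
      sj = lookup-select keep? f n j
    order : ∀ i j → SameOrder (lookup τ i) (lookup τ j) (lookup σ (embed i)) (lookup σ (embed j))
    order i j = sameOrder-cong (sym (value si)) (sym (value sj)) (σ-at i) (σ-at j)
      (sameOrder-sym (sameOrder-kept (position<m si) (position<m sj) (kept si) (kept sj)))
      where
      open SelectedAt using (value; position<m; kept)
      si : SelectedAt keep? f n (toℕ i) (lookup τ i)
      si = lookup-select keep? f n i
      sj : SelectedAt keep? f n (toℕ j) (lookup τ j)
      sj = lookup-select keep? f n j
      σ-at : ∀ j → at σ (position j) ≡ lookup σ (embed j)
      σ-at j = trans (cong (at σ) (sym (toℕ-embed j))) (sym (lookup≡at σ (embed j)))

minimal⇒keepsAll : ∀ (ρ σ : List ℕ) (r : Fin (length ρ) → Fin (length σ)) →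
  1 ≤ length ρ → IsOccurrence ρ σ r → IsMinimal ρ σ →
  ∀ {Keep : Pred ℕ 0ℓ} (keep? : Decidable Keep) (f : ℕ → ℕ) →
  Admissible (length σ) (length ρ) (at σ) (extend r) keep? f →
  ∀ {p} → p < length σ → Keep p
minimal⇒keepsAll ρ σ r nonempty occ (_ , minimal) keep? f adm =
  count≡⇒all keep? (trans (sym (length-select keep? f (length σ))) (cong length τ≡σ))
  where
  open Subsequence ρ σ r occ keep? f adm
  τ≡σ : τ ≡ σ
  τ≡σ = minimal τ
    (τ-inversion , downClosed⇒cayley τ (τ-nonempty nonempty) τ-downClosed , nonempty , rτ , ρ-in-τ)
    (τ-nonempty nonempty , embed , τ-in-σ)

-- Saturated positions

-- a local scope for ℤ's prefix +_, which clashes with sections of ℕ's _+_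
module _ where
  open import Data.Integer using (ℤ; +_; _-_; 0ℤ)

  foldr-⊔-≥-init : ∀ (a : ℤ) (xs : List ℤ) → a ℤ.≤ foldr ℤ._⊔_ a xs
  foldr-⊔-≥-init a [] = ℤ.≤-refl
  foldr-⊔-≥-init a (x ∷ xs) = ℤ.≤-trans (foldr-⊔-≥-init a xs) (ℤ.i≤j⊔i x _)

  foldr-⊔-≥-tabulate : ∀ (a : ℤ) {m} (h : Fin m → ℤ) j → h j ℤ.≤ foldr ℤ._⊔_ a (tabulate h)
  foldr-⊔-≥-tabulate a h Fin.zero = ℤ.i≤i⊔j (h Fin.zero) _
  foldr-⊔-≥-tabulate a h (Fin.suc j) = ℤ.≤-trans (foldr-⊔-≥-tabulate a (h ∘ Fin.suc) j) (ℤ.i≤j⊔i (h Fin.zero) _)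

  foldr-⊔-lub : ∀ {a c : ℤ} {m} (h : Fin m → ℤ) → a ℤ.≤ c → (∀ j → h j ℤ.≤ c) → foldr ℤ._⊔_ a (tabulate h) ℤ.≤ c
  foldr-⊔-lub {m = zero} h a≤c _ = a≤c
  foldr-⊔-lub {m = suc m} h a≤c h≤c = ℤ.⊔-lub (h≤c Fin.zero) (foldr-⊔-lub (h ∘ Fin.suc) a≤c (h≤c ∘ Fin.suc))

  dd≤mdd : ∀ (xs : List ℕ) (j : Fin (length xs)) → dd xs j ℤ.≤ mdd xs
  dd≤mdd (x ∷ xs) Fin.zero = foldr-⊔-≥-init _ (tabulate (dd (x ∷ xs) ∘ Fin.suc))
  dd≤mdd (x ∷ xs) (Fin.suc j) = foldr-⊔-≥-tabulate _ (dd (x ∷ xs) ∘ Fin.suc) j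

  mdd-lub : ∀ (xs : List ℕ) {c} → 1 ≤ length xs → (∀ j → dd xs j ℤ.≤ c) → mdd xs ℤ.≤ c
  mdd-lub (x ∷ xs) _ dd≤c = foldr-⊔-lub (dd (x ∷ xs) ∘ Fin.suc) (dd≤c Fin.zero) (dd≤c ∘ Fin.suc)

  [m-n]+[n+p]≡m+p : ∀ m n p → (+ m - + n) ℤ.+ (+ n ℤ.+ + p) ≡ + (m + p)
  [m-n]+[n+p]≡m+p m n p = begin
    (+ m - + n) ℤ.+ (+ n ℤ.+ + p)       ≡⟨ ℤ.+-assoc (+ m) (ℤ.- + n) (+ n ℤ.+ + p) ⟩
    + m ℤ.+ (ℤ.- + n ℤ.+ (+ n ℤ.+ + p)) ≡⟨ cong (λ x → + m ℤ.+ x) (sym (ℤ.+-assoc (ℤ.- + n) (+ n) (+ p))) ⟩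
    + m ℤ.+ ((ℤ.- + n ℤ.+ + n) ℤ.+ + p) ≡⟨ cong (λ x → + m ℤ.+ (x ℤ.+ + p)) (ℤ.+-inverseˡ (+ n)) ⟩
    + m ℤ.+ (0ℤ ℤ.+ + p)                ≡⟨ cong (λ x → + m ℤ.+ x) (ℤ.+-identityˡ (+ p)) ⟩
    + (m + p)                           ∎
    where open ≡-Reasoning

  m-n≤o-p⇒m+p≤o+n : ∀ {m n o p} → (+ m - + n) ℤ.≤ (+ o - + p) → m + p ≤ o + n
  m-n≤o-p⇒m+p≤o+n {m} {n} {o} {p} le = ℤ.drop‿+≤+ (subst₂ ℤ._≤_ ([m-n]+[n+p]≡m+p m n p)
    (trans (cong (λ x → (+ o - + p) ℤ.+ x) (ℤ.+-comm (+ n) (+ p))) ([m-n]+[n+p]≡m+p o p n))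
    (ℤ.+-monoˡ-≤ (+ n ℤ.+ + p) le))

  tight⇒sat : ∀ (xs : List ℕ) → IsInversion xs → (p : Fin (length xs)) → lookup xs p ≡ toℕ p → InSat xs p
  tight⇒sat xs inversion p tight = ℤ.≤-antisym (dd≤mdd xs p)
    (subst (mdd xs ℤ.≤_) (sym ddp≡0) (mdd-lub xs (≤-trans (s≤s z≤n) (Fin.toℕ<n p)) λ j → ℤ.i≤j⇒i-j≤0 (ℤ.+≤+ (inversion j))))
    where
    ddp≡0 : dd xs p ≡ 0ℤ
    ddp≡0 = trans (cong (λ x → + x - + toℕ p) tight) (ℤ.+-inverseʳ (+ toℕ p))

  saturated-at : ∀ (ρ : List ℕ) (s : Fin (length ρ)) → InSat ρ s →
    ∀ {b} → b < length ρ → at ρ b + toℕ s ≤ at ρ (toℕ s) + b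
  saturated-at ρ s sat {b} b<k = m-n≤o-p⇒m+p≤o+n {at ρ b} {b} {at ρ (toℕ s)} {toℕ s} (subst₂ ℤ._≤_
    (cong₂ (λ x y → + x - + y) (at-fromℕ< ρ b<k) (Fin.toℕ-fromℕ< b<k))
    (trans (sym sat) (cong (λ x → + x - + toℕ s) (lookup≡at ρ s)))
    (dd≤mdd ρ (fromℕ< b<k)))

-- The combinatorial argument

lastCounterexample : ∀ {Q : Pred ℕ 0ℓ} → Decidable Q → ∀ {m i} → i < m → ¬ Q i →
  ∃ λ j → i ≤ j × j < m × ¬ Q j × (∀ {q} → j < q → q < m → Q q)
lastCounterexample {Q} Q? {suc m} {i} i<m ¬Qi with Q? m
... | no ¬Qm = m , s≤s⁻¹ i<m , ≤-refl , ¬Qm , λ m<q q≤m → contradiction (≤-trans m<q (s≤s⁻¹ q≤m)) (n≮n m)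
... | yes Qm with m≤n⇒m<n∨m≡n (s≤s⁻¹ i<m)
...   | inj₂ refl = contradiction Qm ¬Qi
...   | inj₁ i<m′ with lastCounterexample Q? i<m′ ¬Qi
...     | j , i≤j , j<m , ¬Qj , after = j , i≤j , m≤n⇒m≤1+n j<m , ¬Qj , after′
  where
  after′ : ∀ {q} → j < q → q < suc m → Q q
  after′ {q} j<q q<1+m with m≤n⇒m<n∨m≡n (s≤s⁻¹ q<1+m)
  ... | inj₁ q<m = after j<q q<m
  ... | inj₂ refl = Qm

m∸[1+n]+n≡m∸1 : ∀ {n m} → n < m → m ∸ suc n + n ≡ m ∸ 1
m∸[1+n]+n≡m∸1 {m = suc m} (s≤s n≤m) = m∸n+n≡m n≤m

<⇒≤∸1 : ∀ {n m} → n < m → n ≤ m ∸ 1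
<⇒≤∸1 (s≤s n≤m) = n≤m

m∸1<m : ∀ {n m} → n < m → m ∸ 1 < m
m∸1<m {m = suc m} _ = ≤-refl

squeeze : ℕ → ℕ → ℕ
squeeze a x with a <? x
... | yes _ = x ∸ 1
... | no _ = x

squeeze-≤ : ∀ a x → squeeze a x ≤ x
squeeze-≤ a x with a <? x
... | yes _ = m∸n≤m x 1
... | no _ = ≤-refl

squeeze-< : ∀ {a x y} → x ≢ a → x < y → squeeze a x < squeeze a y
squeeze-< {a} {x} {y} x≢a x<y with a <? x | a <? y
... | yes a<x | yes _ = ∸-monoˡ-< x<y (≤-trans (s≤s z≤n) a<x)
... | yes a<x | no a≮y = contradiction (<-trans a<x x<y) a≮y
... | no a≮x | yes a<y = <-≤-trans (≤∧≢⇒< (≮⇒≥ a≮x) x≢a) (<⇒≤pred a<y)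
... | no _ | no _ = x<y

squeeze-below : ∀ {a w} → w < a → squeeze a w ≡ w
squeeze-below {a} {w} w<a with a <? w
... | yes a<w = contradiction a<w (<-asym w<a)
... | no _ = refl

squeeze-above : ∀ {a w} → a ≤ w → squeeze a (suc w) ≡ w
squeeze-above {a} {w} a≤w with a <? suc w
... | yes _ = refl
... | no a≮1+w = contradiction (s≤s a≤w) a≮1+w

squeeze-≥⇒> : ∀ {a w x} → x ≢ a → a ≤ w → w ≤ squeeze a x → w < x
squeeze-≥⇒> {a} {w} {x} x≢a a≤w w≤ with a <? x
... | yes a<x = subst (_≤ x) (+-comm w 1) (m≤o∸n⇒m+n≤o w (≤-trans (s≤s z≤n) a<x) w≤)
... | no a≮x = contradiction (≤-antisym (≮⇒≥ a≮x) (≤-trans a≤w w≤)) x≢a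

module SaturatedOccurrence
  (n k s : ℕ) (S P R : ℕ → ℕ)
  (s<k : s < k)
  (S-inversion : ∀ {p} → p < n → S p ≤ p)
  (S-downClosed : DownClosed S n)
  (P-downClosed : DownClosed P k)
  (R<n : ∀ {b} → b < k → R b < n)
  (R-increasing : ∀ {b c} → b < c → c < k → R b < R c)
  (sameOrder : ∀ {b c} → b < k → c < k → SameOrder (P b) (P c) (S (R b)) (S (R c)))
  (saturated : ∀ {b} → b < k → P b + s ≤ P s + b)
  (keepsAll : ∀ {Keep : Pred ℕ 0ℓ} (keep? : Decidable Keep) (f : ℕ → ℕ) →
     Admissible n k S R keep? f → ∀ {p} → p < n → Keep p)
  where

  v : ℕ
  v = S (R s)

  k∸1<k : k ∸ 1 < k
  k∸1<k = m∸1<m s<k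

  DownClosedOn : Pred ℕ 0ℓ → (ℕ → ℕ) → Set
  DownClosedOn Keep f = ∀ {q w} → q < n → Keep q → w ≤ f q → ∃ λ p → p < n × Keep p × f p ≡ w

  InR : Pred ℕ 0ℓ
  InR p = ∃ λ b → b < k × R b ≡ p

  inR? : Decidable InR
  inR? p = anyUpTo? (λ b → R b ≟ p) k

  R-mono : ∀ {b c} → b ≤ c → c < k → R b ≤ R c
  R-mono b≤c c<k with m≤n⇒m<n∨m≡n b≤c
  ... | inj₁ b<c = <⇒≤ (R-increasing b<c c<k)
  ... | inj₂ refl = ≤-refl

  R-cancel-< : ∀ {b c} → b < k → R b < R c → b < c
  R-cancel-< {b} {c} b<k Rb<Rc = ≰⇒> λ c≤b → <⇒≱ Rb<Rc (R-mono c≤b b<k)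

  R-injective : ∀ {b c} → b < k → c < k → R b ≡ R c → b ≡ c
  R-injective {b} {c} b<k c<k Rb≡Rc with <-cmp b c
  ... | tri< b<c _ _ = contradiction Rb≡Rc (<⇒≢ (R-increasing b<c c<k))
  ... | tri≈ _ b≡c _ = b≡c
  ... | tri> _ _ c<b = contradiction Rb≡Rc (>⇒≢ (R-increasing c<b b<k))

  R-spread : ∀ d {b} → b + d < k → R b + d ≤ R (b + d)
  R-spread zero {b} _ rewrite +-identityʳ b | +-identityʳ (R b) = ≤-refl
  R-spread (suc d) {b} b+d<k rewrite +-suc b d | +-suc (R b) d =
    ≤-trans (s≤s (R-spread d (<⇒≤ b+d<k))) (R-increasing ≤-refl b+d<k)

  R-tight : ∀ d {x} → x + d < k → (∀ {q} → R x < q → q < R (x + d) → InR q) → R (x + d) ≤ R x + d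
  R-tight zero {x} _ _ rewrite +-identityʳ x | +-identityʳ (R x) = ≤-refl
  R-tight (suc d) {x} x+d<k filled rewrite +-suc x d | +-suc (R x) d
    with R (suc (x + d)) ≤? suc (R (x + d))
  ... | yes adjacent = ≤-trans adjacent (s≤s ih)
    where
    ih : R (x + d) ≤ R x + d
    ih = R-tight d (<⇒≤ x+d<k) λ Rx<q q<R → filled Rx<q (<-trans q<R (R-increasing ≤-refl x+d<k))
  ... | no gap with filled (s≤s (R-mono (m≤m+n x d) (<⇒≤ x+d<k))) (≰⇒> gap)
  ...   | c , c<k , Rc≡ = contradiction (R-cancel-< (<⇒≤ x+d<k) (subst (R (x + d) <_) (sym Rc≡) ≤-refl))
                                        (<⇒≱ (R-cancel-< c<k (subst (_< R (suc (x + d))) (sym Rc≡) (≰⇒> gap))))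

  R-strict : ∀ d {x i} → ¬ InR i → x + d < k → R x < i → i < R (x + d) → suc (R x + d) ≤ R (x + d)
  R-strict zero {x} _ _ Rx<i i<Rx rewrite +-identityʳ x = contradiction Rx<i (<-asym i<Rx)
  R-strict (suc d) {x} {i} i∉R x+d<k Rx<i i<R rewrite +-suc x d | +-suc (R x) d with <-cmp i (R (x + d))
  ... | tri< i<R′ _ _ = ≤-trans (s≤s (R-strict d i∉R (<⇒≤ x+d<k) Rx<i i<R′)) (R-increasing ≤-refl x+d<k)
  ... | tri≈ _ i≡R _ = contradiction (x + d , <⇒≤ x+d<k , sym i≡R) i∉R
  ... | tri> _ _ R<i = ≤-trans (s≤s (s≤s (R-spread d (<⇒≤ x+d<k)))) (≤-trans (s≤s R<i) i<R)

  transfer-< : ∀ {b c} → b < k → c < k → P b < P c → S (R b) < S (R c)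
  transfer-< b<k c<k = Equivalence.to (proj₁ (sameOrder b<k c<k))

  reflect-< : ∀ {b c} → b < k → c < k → S (R b) < S (R c) → P b < P c
  reflect-< b<k c<k = Equivalence.from (proj₁ (sameOrder b<k c<k))

  transfer-≡ : ∀ {b c} → b < k → c < k → P b ≡ P c → S (R b) ≡ S (R c)
  transfer-≡ b<k c<k = Equivalence.to (proj₂ (sameOrder b<k c<k))

  reflect-≡ : ∀ {b c} → b < k → c < k → S (R b) ≡ S (R c) → P b ≡ P c
  reflect-≡ b<k c<k = Equivalence.from (proj₂ (sameOrder b<k c<k))

  transfer-≤ : ∀ {b c} → b < k → c < k → P b ≤ P c → S (R b) ≤ S (R c)
  transfer-≤ b<k c<k Pb≤Pc with m≤n⇒m<n∨m≡n Pb≤Pc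
  ... | inj₁ Pb<Pc = <⇒≤ (transfer-< b<k c<k Pb<Pc)
  ... | inj₂ Pb≡Pc = ≤-reflexive (transfer-≡ b<k c<k Pb≡Pc)

  S∘R-spread : ∀ d {b c} → b < k → c < k → P c + d ≡ P b → S (R c) + d ≤ S (R b)
  S∘R-spread zero {c = c} b<k c<k Pc≡Pb rewrite +-identityʳ (P c) | +-identityʳ (S (R c)) =
    ≤-reflexive (transfer-≡ c<k b<k Pc≡Pb)
  S∘R-spread (suc d) {b} {c} b<k c<k Pc+d+1≡Pb with P-downClosed b<k (<⇒≤ Pc+d<Pb)
    where
    Pc+d<Pb : P c + d < P b
    Pc+d<Pb = subst (P c + d <_) Pc+d+1≡Pb (+-monoʳ-< (P c) (n<1+n d))
  ... | x , x<k , Px≡Pc+d = subst (_≤ S (R b)) (sym (+-suc (S (R c)) d))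
        (≤-trans (s≤s (S∘R-spread d x<k c<k (sym Px≡Pc+d))) (transfer-< x<k b<k Px<Pb))
    where
    Px<Pb : P x < P b
    Px<Pb = subst₂ _<_ (sym Px≡Pc+d) Pc+d+1≡Pb (+-monoʳ-< (P c) (n<1+n d))

  P-below-s : ∀ {b} → b < s → P b < P s
  P-below-s {b} b<s = +-cancelʳ-< s (P b) (P s) (≤-<-trans (saturated (<-trans b<s s<k)) (+-monoʳ-< (P s) b<s))

  P-above-s : ∀ {b} → s ≤ b → b < k → P b ≤ P s + (b ∸ s)
  P-above-s {b} s≤b b<k = +-cancelʳ-≤ s (P b) (P s + (b ∸ s)) (subst (P b + s ≤_) split (saturated b<k))
    where
    split : P s + b ≡ P s + (b ∸ s) + s
    split = trans (cong (P s +_) (sym (m∸n+n≡m s≤b))) (sym (+-assoc (P s) (b ∸ s) s))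

  P-below-s-spread : ∀ {b} → b ≤ s → b < k → P b + (s ∸ b) ≤ P s
  P-below-s-spread {b} b≤s b<k = +-cancelʳ-≤ b (P b + (s ∸ b)) (P s) (subst (_≤ P s + b) split (saturated b<k))
    where
    split : P b + s ≡ P b + (s ∸ b) + b
    split = trans (cong (P b +_) (sym (m∸n+n≡m b≤s))) (sym (+-assoc (P b) (s ∸ b) b))

  module LargeEntries where

    Keep : Pred ℕ 0ℓ
    Keep p = InR p ⊎ S p < v

    keep? : Decidable Keep
    keep? p = inR? p ⊎-dec (S p <? v)

    index : ℕ → ℕ
    index p with inR? p
    ... | yes (b , _) = b
    ... | no _ = 0

    index-R : ∀ {b} → b < k → index (R b) ≡ b
    index-R {b} b<k with inR? (R b)
    ... | yes (c , c<k , Rc≡Rb) = R-injective c<k b<k Rc≡Rb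
    ... | no Rb∉R = contradiction (b , b<k , refl) Rb∉R

    relabel : ℕ → ℕ
    relabel p with S p <? v
    ... | yes _ = S p
    ... | no _ = v + (P (index p) ∸ P s)

    relabel-small : ∀ {p} → S p < v → relabel p ≡ S p
    relabel-small {p} small with S p <? v
    ... | yes _ = refl
    ... | no large = contradiction small large

    relabel-R : ∀ {b} → b < k → ¬ S (R b) < v → relabel (R b) ≡ v + (P b ∸ P s)
    relabel-R {b} b<k large with S (R b) <? v
    ... | yes small = contradiction small large
    ... | no _ = cong (λ c → v + (P c ∸ P s)) (index-R b<k)

    large-R : ∀ {b} → b < k → ¬ S (R b) < v → s ≤ b × P s ≤ P b
    large-R {b} b<k large = ≮⇒≥ (λ b<s → <⇒≱ (P-below-s b<s) Ps≤Pb) , Ps≤Pb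
      where
      Ps≤Pb : P s ≤ P b
      Ps≤Pb = ≮⇒≥ λ Pb<Ps → large (transfer-< b<k s<k Pb<Ps)

    kept-large : ∀ {p} → Keep p → ¬ S p < v → InR p
    kept-large (inj₁ p∈R) _ = p∈R
    kept-large (inj₂ small) large = contradiction small large

    v≤relabel : ∀ {p} → Keep p → ¬ S p < v → v ≤ relabel p
    v≤relabel kp large with kept-large kp large
    ... | b , b<k , refl = subst (v ≤_) (sym (relabel-R b<k large)) (m≤m+n v _)

    dropped⇒v≤ : ∀ {p} → p < n → ¬ Keep p → v ≤ p
    dropped⇒v≤ p<n ¬kp = ≤-trans (≮⇒≥ (¬kp ∘ inj₂)) (S-inversion p<n)

    v≤count : v ≤ count keep? (R s)
    v≤count = ≤-count keep? (S-inversion (R<n s<k)) λ q<Rs → dropped⇒v≤ (<-trans q<Rs (R<n s<k))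

    count-R-spread : ∀ d {x} → x + d < k → count keep? (R x) + d ≤ count keep? (R (x + d))
    count-R-spread zero {x} _ rewrite +-identityʳ x | +-identityʳ (count keep? (R x)) = ≤-refl
    count-R-spread (suc d) {x} x+d<k rewrite +-suc x d | +-suc (count keep? (R x)) d =
      ≤-trans (s≤s (count-R-spread d x+d′<k))
              (count-< keep? (R-increasing ≤-refl x+d<k) (inj₁ (x + d , x+d′<k , refl)))
      where
      x+d′<k : x + d < k
      x+d′<k = <⇒≤ x+d<k

    preserves-< : ∀ {p q} → p < n → q < n → Keep p → Keep q → S p < S q → relabel p < relabel q
    preserves-< {p} {q} _ _ kp kq Sp<Sq with v ≤? S p | v ≤? S q
    ... | no p-small | no q-small =
      subst₂ _<_ (sym (relabel-small (≰⇒> p-small))) (sym (relabel-small (≰⇒> q-small))) Sp<Sq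
    ... | no p-small | yes v≤Sq =
      subst (_< relabel q) (sym (relabel-small (≰⇒> p-small))) (<-≤-trans (≰⇒> p-small) (v≤relabel kq (≤⇒≯ v≤Sq)))
    ... | yes v≤Sp | no q-small = contradiction (<-≤-trans (≰⇒> q-small) v≤Sp) (<-asym Sp<Sq)
    ... | yes v≤Sp | yes v≤Sq with kept-large kp (≤⇒≯ v≤Sp) | kept-large kq (≤⇒≯ v≤Sq)
    ...   | x , x<k , refl | y , y<k , refl =
      subst₂ _<_ (sym (relabel-R x<k (≤⇒≯ v≤Sp))) (sym (relabel-R y<k (≤⇒≯ v≤Sq)))
        (+-monoʳ-< v (∸-monoˡ-< (reflect-< x<k y<k Sp<Sq) (proj₂ (large-R x<k (≤⇒≯ v≤Sp)))))

    preserves-≡ : ∀ {p q} → p < n → q < n → Keep p → Keep q → S p ≡ S q → relabel p ≡ relabel q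
    preserves-≡ {p} {q} _ _ kp kq Sp≡Sq with v ≤? S p | v ≤? S q
    ... | no p-small | no q-small =
      trans (relabel-small (≰⇒> p-small)) (trans Sp≡Sq (sym (relabel-small (≰⇒> q-small))))
    ... | no p-small | yes v≤Sq = contradiction (subst (_< v) Sp≡Sq (≰⇒> p-small)) (≤⇒≯ v≤Sq)
    ... | yes v≤Sp | no q-small = contradiction (subst (_< v) (sym Sp≡Sq) (≰⇒> q-small)) (≤⇒≯ v≤Sp)
    ... | yes v≤Sp | yes v≤Sq with kept-large kp (≤⇒≯ v≤Sp) | kept-large kq (≤⇒≯ v≤Sq)
    ...   | x , x<k , refl | y , y<k , refl =
      trans (relabel-R x<k (≤⇒≯ v≤Sp))
        (trans (cong (λ z → v + (z ∸ P s)) (reflect-≡ x<k y<k Sp≡Sq)) (sym (relabel-R y<k (≤⇒≯ v≤Sq))))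

    inversion : ∀ {p} → p < n → Keep p → relabel p ≤ count keep? p
    inversion {p} p<n kp with v ≤? S p
    ... | no p-small = subst (_≤ count keep? p) (sym (relabel-small (≰⇒> p-small)))
        (≤-count keep? (S-inversion p<n) λ q<p ¬kq →
          ≤-trans (<⇒≤ (≰⇒> p-small)) (dropped⇒v≤ (<-trans q<p p<n) ¬kq))
    ... | yes v≤Sp with kept-large kp (≤⇒≯ v≤Sp)
    ...   | b , b<k , refl = begin
      relabel (R b)                          ≡⟨ relabel-R b<k (≤⇒≯ v≤Sp) ⟩
      v + (P b ∸ P s)                        ≤⟨ +-mono-≤ v≤count (m≤n+o⇒m∸n≤o (P b) (P s) (P-above-s s≤b b<k)) ⟩
      count keep? (R s) + (b ∸ s)            ≤⟨ count-R-spread (b ∸ s) (subst (_< k) (sym s+[b∸s]≡b) b<k) ⟩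
      count keep? (R (s + (b ∸ s)))          ≡⟨ cong (count keep? ∘ R) s+[b∸s]≡b ⟩
      count keep? (R b)                      ∎
      where
      open ≤-Reasoning
      s≤b : s ≤ b
      s≤b = proj₁ (large-R b<k (≤⇒≯ v≤Sp))
      s+[b∸s]≡b : s + (b ∸ s) ≡ b
      s+[b∸s]≡b = m+[n∸m]≡n s≤b

    downClosed : DownClosedOn Keep relabel
    downClosed {q} {w} q<n kq w≤ with w <? v
    ... | yes w<v with S-downClosed (R<n s<k) (<⇒≤ w<v)
    ...   | p , p<n , Sp≡w = p , p<n , inj₂ (subst (_< v) (sym Sp≡w) w<v) ,
                             trans (relabel-small (subst (_< v) (sym Sp≡w) w<v)) Sp≡w
    downClosed {q} {w} q<n kq w≤ | no w≮v with v ≤? S q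
    ...   | no q-small = contradiction (≤-<-trans (subst (w ≤_) (relabel-small (≰⇒> q-small)) w≤) (≰⇒> q-small)) w≮v
    ...   | yes v≤Sq with kept-large kq (≤⇒≯ v≤Sq)
    ...     | b , b<k , refl with P-downClosed b<k Ps+[w∸v]≤Pb
      where
      Ps≤Pb : P s ≤ P b
      Ps≤Pb = proj₂ (large-R b<k (≤⇒≯ v≤Sq))
      w∸v≤ : w ∸ v ≤ P b ∸ P s
      w∸v≤ = m≤n+o⇒m∸n≤o w v (subst (w ≤_) (relabel-R b<k (≤⇒≯ v≤Sq)) w≤)
      Ps+[w∸v]≤Pb : P s + (w ∸ v) ≤ P b
      Ps+[w∸v]≤Pb = ≤-trans (+-monoʳ-≤ (P s) w∸v≤) (≤-reflexive (m+[n∸m]≡n Ps≤Pb))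
    ...       | e , e<k , Pe≡ = R e , R<n e<k , inj₁ (e , e<k , refl) , relabel-Re≡w
      where
      open ≡-Reasoning
      relabel-Re≡w : relabel (R e) ≡ w
      relabel-Re≡w = begin
        relabel (R e)                ≡⟨ relabel-R e<k (≤⇒≯ (transfer-≤ s<k e<k (subst (P s ≤_) (sym Pe≡) (m≤m+n (P s) _)))) ⟩
        v + (P e ∸ P s)              ≡⟨ cong (λ x → v + (x ∸ P s)) Pe≡ ⟩
        v + (P s + (w ∸ v) ∸ P s)    ≡⟨ cong (v +_) (m+n∸m≡n (P s) (w ∸ v)) ⟩
        v + (w ∸ v)                  ≡⟨ m+[n∸m]≡n (≮⇒≥ w≮v) ⟩
        w                            ∎

    admissible : Admissible n k S R keep? relabel
    admissible = record
      { keeps-R = λ b<k → inj₁ (_ , b<k , refl)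
      ; preserves-< = preserves-<
      ; preserves-≡ = preserves-≡
      ; inversion = inversion
      ; downClosed = downClosed
      }

  large⇒inR : ∀ {i} → i < n → v ≤ S i → InR i
  large⇒inR i<n v≤Si with keepsAll keep? relabel admissible i<n
    where open LargeEntries
  ... | inj₁ i∈R = i∈R
  ... | inj₂ small = contradiction small (≤⇒≯ v≤Si)

  module Deletion {i} (i<n : i < n) (i∉R : ¬ InR i) (untight : ∀ {p} → i < p → p < n → S p < p) where

    keep? : Decidable (_≢ i)
    keep? p = ¬? (p ≟ i)

    keeps-R : ∀ {b} → b < k → R b ≢ i
    keeps-R b<k Rb≡i = i∉R (_ , b<k , Rb≡i)

    count-below : ∀ {p} → p ≤ i → count keep? p ≡ p
    count-below {zero} _ = refl
    count-below {suc p} p<i = trans (count-snoc-yes keep? (<⇒≢ p<i)) (cong suc (count-below (<⇒≤ p<i)))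

    count-above : ∀ {p} → i < p → suc (count keep? p) ≡ p
    count-above {suc p} i<1+p with m≤n⇒m<n∨m≡n (s≤s⁻¹ i<1+p)
    ... | inj₂ refl = cong suc (trans (count-snoc-no keep? (λ i≢i → i≢i refl)) (count-below ≤-refl))
    ... | inj₁ i<p = cong suc (trans (count-snoc-yes keep? (>⇒≢ i<p)) (count-above i<p))

    inversion : ∀ {p} → p < n → p ≢ i → S p ≤ count keep? p
    inversion {p} p<n _ with p ≤? i
    ... | yes p≤i = subst (S p ≤_) (sym (count-below p≤i)) (S-inversion p<n)
    ... | no p≰i = s≤s⁻¹ (subst (S p <_) (sym (count-above (≰⇒> p≰i))) (untight (≰⇒> p≰i) p<n))

    module Repeated {j} (j<n : j < n) (j≢i : j ≢ i) (Sj≡Si : S j ≡ S i) where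

      admissible : Admissible n k S R keep? S
      admissible = record
        { keeps-R = keeps-R
        ; preserves-< = λ _ _ _ _ Sp<Sq → Sp<Sq
        ; preserves-≡ = λ _ _ _ _ Sp≡Sq → Sp≡Sq
        ; inversion = inversion
        ; downClosed = downClosed
        }
        where
        downClosed : DownClosedOn (_≢ i) S
        downClosed q<n _ w≤Sq with S-downClosed q<n w≤Sq
        ... | p , p<n , Sp≡w with p ≟ i
        ...   | yes refl = j , j<n , j≢i , trans Sj≡Si Sp≡w
        ...   | no p≢i = p , p<n , p≢i , Sp≡w

    module Unique (unique : ∀ {q} → q < n → q ≢ i → S q ≢ S i) where

      admissible : Admissible n k S R keep? (squeeze (S i) ∘ S)
      admissible = record
        { keeps-R = keeps-R
        ; preserves-< = λ p<n _ p≢i _ → squeeze-< (unique p<n p≢i)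
        ; preserves-≡ = λ _ _ _ _ → cong (squeeze (S i))
        ; inversion = λ p<n p≢i → ≤-trans (squeeze-≤ (S i) _) (inversion p<n p≢i)
        ; downClosed = downClosed
        }
        where
        downClosed : DownClosedOn (_≢ i) (squeeze (S i) ∘ S)
        downClosed {q} {w} q<n q≢i w≤ with w <? S i
        ... | yes w<Si with S-downClosed q<n (≤-trans w≤ (squeeze-≤ (S i) (S q)))
        ...   | p , p<n , Sp≡w = p , p<n , (λ { refl → <-irrefl (sym Sp≡w) w<Si }) ,
                                 trans (cong (squeeze (S i)) Sp≡w) (squeeze-below w<Si)
        downClosed {q} {w} q<n q≢i w≤ | no w≮Si
          with S-downClosed q<n (squeeze-≥⇒> (unique q<n q≢i) (≮⇒≥ w≮Si) w≤)
        ...   | p , p<n , Sp≡1+w = p , p<n , (λ { refl → <-irrefl Sp≡1+w (s≤s (≮⇒≥ w≮Si)) }) ,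
                                   trans (cong (squeeze (S i)) Sp≡1+w) (squeeze-above (≮⇒≥ w≮Si))

    contradiction-i : ⊥
    contradiction-i with anyUpTo? (λ q → ¬? (q ≟ i) ×-dec (S q ≟ S i)) n
    ... | yes (j , j<n , j≢i , Sj≡Si) = keepsAll keep? S (Repeated.admissible j<n j≢i Sj≡Si) i<n refl
    ... | no no-repeat = keepsAll keep? (squeeze (S i) ∘ S) (Unique.admissible unique) i<n refl
      where
      unique : ∀ {q} → q < n → q ≢ i → S q ≢ S i
      unique q<n q≢i Sq≡Si = no-repeat (_ , q<n , q≢i , Sq≡Si)

  no-deletable-entry : ∀ {i} → i < n → ¬ InR i → ¬ (∀ {p} → i < p → p < n → S p < p)
  no-deletable-entry i<n i∉R untight = Deletion.contradiction-i i<n i∉R untight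

  P-spread-above-v : ∀ d {b} → b < k → v + d ≡ S (R b) → P s + d ≤ P b
  P-spread-above-v zero {b} b<k v≡SRb rewrite +-identityʳ v | +-identityʳ (P s) =
    ≤-reflexive (reflect-≡ s<k b<k v≡SRb)
  P-spread-above-v (suc d) {b} b<k v+d+1≡SRb with S-downClosed (R<n b<k) (<⇒≤ v+d<SRb)
    where
    v+d<SRb : v + d < S (R b)
    v+d<SRb = subst (v + d <_) v+d+1≡SRb (+-monoʳ-< v (n<1+n d))
  ... | i , i<n , Si≡v+d with large⇒inR i<n (subst (v ≤_) (sym Si≡v+d) (m≤m+n v d))
  ...   | x , x<k , refl = subst (_≤ P b) (sym (+-suc (P s) d))
          (≤-trans (s≤s (P-spread-above-v d x<k (sym Si≡v+d))) (reflect-< x<k b<k SRx<SRb))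
    where
    SRx<SRb : S (R x) < S (R b)
    SRx<SRb = subst₂ _<_ (sym Si≡v+d) v+d+1≡SRb (+-monoʳ-< v (n<1+n d))

  tight-upTo-s : ∀ {b} → b ≤ s → S (R b) ≡ R b → (∀ {q} → R b < q → q < R s → InR q) → R s ≤ v
  tight-upTo-s {b} b≤s tight filled = begin
    R s                         ≡⟨ cong R (sym b+d≡s) ⟩
    R (b + d)                   ≤⟨ R-tight d (subst (_< k) (sym b+d≡s) s<k) (λ {q} Rb<q q<R → filled Rb<q (subst (λ x → q < R x) b+d≡s q<R)) ⟩
    R b + d                     ≡⟨ cong (_+ d) (sym tight) ⟩
    S (R b) + d                 ≤⟨ +-monoʳ-≤ (S (R b)) d≤Ps∸Pb ⟩
    S (R b) + (P s ∸ P b)       ≤⟨ S∘R-spread (P s ∸ P b) s<k b<k (m+[n∸m]≡n (m+n≤o⇒m≤o (P b) Pb+d≤Ps)) ⟩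
    v                           ∎
    where
    open ≤-Reasoning
    d : ℕ
    d = s ∸ b
    b+d≡s : b + d ≡ s
    b+d≡s = m+[n∸m]≡n b≤s
    b<k : b < k
    b<k = ≤-<-trans b≤s s<k
    Pb+d≤Ps : P b + d ≤ P s
    Pb+d≤Ps = P-below-s-spread b≤s b<k
    d≤Ps∸Pb : d ≤ P s ∸ P b
    d≤Ps∸Pb = m+n≤o⇒m≤o∸n d (subst (_≤ P s) (+-comm (P b) d) Pb+d≤Ps)

  tight-from-s : ∀ {b} → s ≤ b → b < k → S (R b) ≡ R b → R b ≤ v + (b ∸ s)
  tight-from-s {b} s≤b b<k tight with P b <? P s
  ... | yes Pb<Ps = contradiction (transfer-< b<k s<k Pb<Ps)
        (≤⇒≯ (≤-trans (S-inversion (R<n s<k)) (≤-trans (R-mono s≤b b<k) (≤-reflexive (sym tight)))))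
  ... | no Pb≮Ps = begin
    R b                         ≡⟨ sym tight ⟩
    S (R b)                     ≤⟨ m≤n+m∸n (S (R b)) v ⟩
    v + (S (R b) ∸ v)           ≤⟨ +-monoʳ-≤ v (+-cancelˡ-≤ (P s) _ _ (≤-trans spread (P-above-s s≤b b<k))) ⟩
    v + (b ∸ s)                 ∎
    where
    open ≤-Reasoning
    v≤SRb : v ≤ S (R b)
    v≤SRb = transfer-≤ s<k b<k (≮⇒≥ Pb≮Ps)
    spread : P s + (S (R b) ∸ v) ≤ P b
    spread = P-spread-above-v (S (R b) ∸ v) b<k (m+[n∸m]≡n v≤SRb)

  no-tight-after-gap : ∀ {i} → ¬ InR i → (∀ {q} → i < q → q < n → InR q) → R s < i ⊎ v < R s →
    ∀ {p} → i < p → p < n → S p ≢ p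
  no-tight-after-gap {i} i∉R after gap {p} i<p p<n tight with after i<p p<n
  ... | b , b<k , refl with b ≤? s
  ...   | yes b≤s = [ (λ Rs<i → <-asym Rs<i (<-≤-trans i<p (R-mono b≤s s<k))) , (λ v<Rs → ≤⇒≯ Rs≤v v<Rs) ]′ gap
    where
    Rs≤v : R s ≤ v
    Rs≤v = tight-upTo-s b≤s tight λ Rb<q q<Rs → after (<-trans i<p Rb<q) (<-trans q<Rs (R<n s<k))
  ...   | no b≰s = ≤⇒≯ (tight-from-s s≤b b<k tight) v+d<Rb
    where
    s≤b : s ≤ b
    s≤b = <⇒≤ (≰⇒> b≰s)
    d : ℕ
    d = b ∸ s
    s+d≡b : s + d ≡ b
    s+d≡b = m+[n∸m]≡n s≤b
    s+d<k : s + d < k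
    s+d<k = subst (_< k) (sym s+d≡b) b<k
    v+d<Rb : v + d < R b
    v+d<Rb = subst (λ x → v + d < R x) s+d≡b ([ strict-gap , shifted ]′ gap)
      where
      strict-gap : R s < i → v + d < R (s + d)
      strict-gap Rs<i = ≤-trans (s≤s (+-monoˡ-≤ d (S-inversion (R<n s<k))))
        (R-strict d i∉R s+d<k Rs<i (subst (λ x → i < R x) (sym s+d≡b) i<p))
      shifted : v < R s → v + d < R (s + d)
      shifted v<Rs = <-≤-trans (+-monoˡ-< d v<Rs) (R-spread d s+d<k)

  last-gap-impossible : ∀ {i} → i < n → ¬ InR i → (∀ {q} → i < q → q < n → InR q) → ¬ (R s < i ⊎ v < R s)
  last-gap-impossible i<n i∉R after gap = no-deletable-entry i<n i∉R λ i<p p<n →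
    ≤∧≢⇒< (S-inversion p<n) (no-tight-after-gap i∉R after gap i<p p<n)

  outside-R⇒<Rs : ∀ {i} → i < n → ¬ InR i → i < R s
  outside-R⇒<Rs {i} i<n i∉R with i <? R s
  ... | yes i<Rs = i<Rs
  ... | no i≮Rs with lastCounterexample inR? i<n i∉R
  ...   | j , i≤j , j<n , j∉R , after = contradiction (inj₁ (<-≤-trans Rs<i i≤j)) (last-gap-impossible j<n j∉R after)
    where
    Rs<i : R s < i
    Rs<i = ≤∧≢⇒< (≮⇒≥ i≮Rs) λ Rs≡i → i∉R (s , s<k , Rs≡i)

  Rs≤⇒inR : ∀ {q} → R s ≤ q → q < n → InR q
  Rs≤⇒inR {q} Rs≤q q<n with inR? q
  ... | yes q∈R = q∈R
  ... | no q∉R = contradiction Rs≤q (<⇒≱ (outside-R⇒<Rs q<n q∉R))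

  v≡Rs : v ≡ R s
  v≡Rs = ≤-antisym (S-inversion (R<n s<k)) (≮⇒≥ v≮Rs)
    where
    v≮Rs : ¬ v < R s
    v≮Rs v<Rs with anyUpTo? (¬? ∘ inR?) n
    ... | yes (i , i<n , i∉R) with lastCounterexample inR? i<n i∉R
    ...   | j , _ , j<n , j∉R , after = last-gap-impossible j<n j∉R after (inj₂ v<Rs)
    v≮Rs v<Rs | no all-in-R = <⇒≱ v<Rs (begin
      R s           ≤⟨ R-tight s s<k (λ _ q<Rs → inR (<-trans q<Rs (R<n s<k))) ⟩
      R 0 + s       ≤⟨ +-monoˡ-≤ s R0≤0 ⟩
      s             ≤⟨ m+n≤o⇒n≤o (P 0) (subst (P 0 + s ≤_) (+-identityʳ (P s)) (saturated 0<k)) ⟩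
      P s           ≤⟨ m+n≤o⇒n≤o (S (R e)) (S∘R-spread (P s) s<k e<k (cong (_+ P s) Pe≡0)) ⟩
      v             ∎)
      where
      open ≤-Reasoning
      0<k : 0 < k
      0<k = ≤-<-trans z≤n s<k
      inR : ∀ {q} → q < n → InR q
      inR {q} q<n with inR? q
      ... | yes q∈R = q∈R
      ... | no q∉R = contradiction (q , q<n , q∉R) all-in-R
      R0≤0 : R 0 ≤ 0
      R0≤0 with inR (≤-<-trans z≤n (R<n 0<k))
      ... | c , c<k , Rc≡0 = subst (R 0 ≤_) Rc≡0 (R-mono z≤n c<k)
      e : ℕ
      e = proj₁ (P-downClosed s<k z≤n)
      e<k : e < k
      e<k = proj₁ (proj₂ (P-downClosed s<k z≤n))
      Pe≡0 : P e ≡ 0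
      Pe≡0 = proj₂ (proj₂ (P-downClosed s<k z≤n))

  R-consecutive : ∀ d {b} → s ≤ b → b + d < k → R (b + d) ≡ R b + d
  R-consecutive d {b} s≤b b+d<k = ≤-antisym
    (R-tight d b+d<k λ Rb<q q<R → Rs≤⇒inR (≤-trans (R-mono s≤b b<k) (<⇒≤ Rb<q)) (<-trans q<R (R<n b+d<k)))
    (R-spread d b+d<k)
    where
    b<k : b < k
    b<k = ≤-<-trans (m≤m+n b d) b+d<k

  R-last : suc (R (k ∸ 1)) ≡ n
  R-last = ≤-antisym (R<n k∸1<k) (≮⇒≥ λ 1+R<n → last-not-max (Rs≤⇒inR Rs≤1+R 1+R<n))
    where
    Rs≤1+R : R s ≤ suc (R (k ∸ 1))
    Rs≤1+R = ≤-trans (R-mono (<⇒≤∸1 s<k) k∸1<k) (n≤1+n _)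
    last-not-max : ¬ InR (suc (R (k ∸ 1)))
    last-not-max (c , c<k , Rc≡) = <⇒≱ (R-cancel-< k∸1<k (subst (R (k ∸ 1) <_) (sym Rc≡) ≤-refl)) (<⇒≤∸1 c<k)

  R-tail : ∀ {j} → j < k → s ≤ k ∸ suc j → R (k ∸ suc j) ≡ n ∸ 1 ∸ j
  R-tail {j} j<k s≤ = begin
    R (k ∸ suc j)                   ≡⟨ sym (m+n∸n≡m _ j) ⟩
    R (k ∸ suc j) + j ∸ j           ≡⟨ cong (_∸ j) (sym (R-consecutive j s≤ (subst (_< k) (sym eq) k∸1<k))) ⟩
    R (k ∸ suc j + j) ∸ j           ≡⟨ cong (λ x → R x ∸ j) eq ⟩
    R (k ∸ 1) ∸ j                   ≡⟨ cong (λ x → x ∸ 1 ∸ j) R-last ⟩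
    n ∸ 1 ∸ j                       ∎
    where
    open ≡-Reasoning
    eq : k ∸ suc j + j ≡ k ∸ 1
    eq = m∸[1+n]+n≡m∸1 j<k

proposition3p2 : (ρ σ : List ℕ) → 1 ≤ length ρ → 1 ≤ length σ
    → IsCayley ρ → IsInversion σ
    → (ℓ : Fin (length ρ)) → InSat ρ (opposite ℓ)
    → (r : Fin (length ρ) → Fin (length σ)) → IsOccurrence ρ σ r
    → IsMinimal ρ σ
    → ((i : Fin (length σ)) → lookup σ (r (opposite ℓ)) ≤ lookup σ i → ∃ λ j → r j ≡ i)
      × ((i : Fin (length ρ)) → toℕ i ≤ toℕ ℓ → toℕ (r (opposite i)) ≡ length σ ∸ 1 ∸ toℕ i)
      × (Σ (Fin (length σ)) λ p → (toℕ p ≡ length σ ∸ 1 ∸ toℕ ℓ) × InSat σ p)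
proposition3p2 ρ σ 1≤k _ ρ-cayley σ-inversion ℓ sat r occ minimal = large-entries-in-R , R-ends-at-n , r s , R-ends-at-n ℓ ≤-refl , R-saturated
  where
  s : Fin (length ρ)
  s = opposite ℓ
  σ-cayley : IsCayley σ
  σ-cayley = proj₁ (proj₂ (proj₁ minimal))
  open OccurrenceOnℕ ρ σ r occ
  open SaturatedOccurrence (length σ) (length ρ) (toℕ s) (at σ) (at ρ) (extend r) (Fin.toℕ<n s)
    (inversion-at σ σ-inversion) (cayley⇒downClosed σ σ-cayley) (cayley⇒downClosed ρ ρ-cayley)
    (extend-< r) increasing sameOrder (saturated-at ρ s sat) (minimal⇒keepsAll ρ σ r 1≤k occ minimal)

  large-entries-in-R : (i : Fin (length σ)) → lookup σ (r s) ≤ lookup σ i → ∃ λ j → r j ≡ i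
  large-entries-in-R i σrs≤σi =
    let b , b<k , Rb≡i = large⇒inR (Fin.toℕ<n i) (subst₂ _≤_ (lookup∘r≡at∘extend σ r s) (lookup≡at σ i) σrs≤σi)
    in fromℕ< b<k , Fin.toℕ-injective (trans (sym (extend-fromℕ< r b<k)) Rb≡i)

  R-ends-at-n : (i : Fin (length ρ)) → toℕ i ≤ toℕ ℓ → toℕ (r (opposite i)) ≡ length σ ∸ 1 ∸ toℕ i
  R-ends-at-n i i≤ℓ = begin
    toℕ (r (opposite i))               ≡⟨ sym (extend-toℕ r (opposite i)) ⟩
    extend r (toℕ (opposite i))        ≡⟨ cong (extend r) (Fin.opposite-prop i) ⟩
    extend r (length ρ ∸ suc (toℕ i))  ≡⟨ R-tail (Fin.toℕ<n i) s≤ ⟩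
    length σ ∸ 1 ∸ toℕ i               ∎
    where
    open ≡-Reasoning
    s≤ : toℕ s ≤ length ρ ∸ suc (toℕ i)
    s≤ = subst (_≤ length ρ ∸ suc (toℕ i)) (sym (Fin.opposite-prop ℓ)) (∸-monoʳ-≤ (length ρ) (s≤s i≤ℓ))

  R-saturated : InSat σ (r s)
  R-saturated = tight⇒sat σ σ-inversion (r s) (trans (lookup∘r≡at∘extend σ r s) (trans v≡Rs (extend-toℕ r s)))
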